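{- Let $\langle L,G,H,F,P\rangle$ be a tense ICRDL-algebra. Then for all $x,y\in L$: $G(x)\cdot F(x\to y)\le F(y)$ and $H(x)\cdot P(x\to y)\le P(y)$.
   Context: An ICRDL-algebra is a structure $\langle L,\vee,\wedge,\cdot,\to,0,1\rangle$ such that $\langle L,\vee,\wedge,0,1\rangle$ is a bounded distributive lattice, $\langle L,\cdot,1\rangle$ is a commutative monoid, and $x\cdot y\le z$ iff $x\le y\to z$. A tense ICRDL-algebra is an ICRDL-algebra with unary operations $G,H,F,P$ satisfying: (T1) $P(x)\le y$ iff $x\le G(y)$; (T2) $F(x)\le y$ iff $x\le H(y)$; (T3) $G(0)=0$, $H(0)=0$; (T4) $G(x)\cdot F(y)\le F(x\cdot y)$ and $H(x)\cdot P(y)\le P(x\cdot y)$; (T5) $G(x\vee y)\le G(x)\vee F(y)$ and $H(x\vee y)\le H(x)\vee P(y)$; (T6) $G(x\to y)\le G(x)\to G(y)$ and $H(x\to y)\le H(x)\to H(y)$. -}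

module Defs where

open import Level using (Level; _⊔_; suc)
open import Data.Product using (_×_)
open import Relation.Binary.Core using (Rel)
open import Algebra.Core using (Op₁; Op₂)
open import Algebra.Structures using (IsCommutativeMonoid)
open import Algebra.Lattice.Structures using (IsDistributiveLattice)

record TenseICRDL (c ℓ : Level) : Set (suc (c ⊔ ℓ)) where
  infix  4 _≈_ _≤_
  infixr 5 _→'_
  infixl 7 _·_
  infixr 6 _∨_
  infixr 7 _∧_
  field
    Carrier : Set c
    _≈_     : Rel Carrier ℓ
    _∨_ _∧_ _·_ _→'_ : Op₂ Carrier
    𝟘 𝟙     : Carrier
    G H F P : Op₁ Carrier

  _≤_ : Rel Carrier ℓ
  x ≤ y = (x ∧ y) ≈ x

  field
    isDistributiveLattice : IsDistributiveLattice _≈_ _∨_ _∧_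
    𝟘-bottom : ∀ x → 𝟘 ≤ x
    𝟙-top    : ∀ x → x ≤ 𝟙
    isCommutativeMonoid : IsCommutativeMonoid _≈_ _·_ 𝟙
    →-cong : ∀ {x x' y y'} → x ≈ x' → y ≈ y' → (x →' y) ≈ (x' →' y')
    residuation₁ : ∀ x y z → x · y ≤ z → x ≤ y →' z
    residuation₂ : ∀ x y z → x ≤ y →' z → x · y ≤ z
    G-cong : ∀ {x y} → x ≈ y → G x ≈ G y
    H-cong : ∀ {x y} → x ≈ y → H x ≈ H y
    F-cong : ∀ {x y} → x ≈ y → F x ≈ F y
    P-cong : ∀ {x y} → x ≈ y → P x ≈ P y
    T1₁ : ∀ x y → P x ≤ y → x ≤ G y
    T1₂ : ∀ x y → x ≤ G y → P x ≤ y
    T2₁ : ∀ x y → F x ≤ y → x ≤ H y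
    T2₂ : ∀ x y → x ≤ H y → F x ≤ y
    T3G : G 𝟘 ≈ 𝟘
    T3H : H 𝟘 ≈ 𝟘
    T4G : ∀ x y → G x · F y ≤ F (x · y)
    T4H : ∀ x y → H x · P y ≤ P (x · y)
    T5G : ∀ x y → G (x ∨ y) ≤ G x ∨ F y
    T5H : ∀ x y → H (x ∨ y) ≤ H x ∨ P y
    T6G : ∀ x y → G (x →' y) ≤ G x →' G y
    T6H : ∀ x y → H (x →' y) ≤ H x →' H y

{-# OPTIONS --safe #-}
-- Tense operators F and P are lower adjoints, hence monotone; by (T4)
-- G x · F (x → y) ≤ F (x · (x → y)), and modus ponens x · (x → y) ≤ y
-- finishes the argument (dually for H and P).
module Submission where

open import Defs
open import Level using (Level)
open import Data.Product using (_×_; _,_)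
open import Algebra.Structures using (IsCommutativeMonoid)
open import Algebra.Lattice.Bundles using (Lattice)
open import Algebra.Lattice.Structures using (IsDistributiveLattice)
import Algebra.Lattice.Properties.Lattice as LatticeProperties
open import Relation.Binary.Bundles using (Poset)

module TenseICRDLProperties {c ℓ : Level} (A : TenseICRDL c ℓ) where
  open TenseICRDL A
  open IsDistributiveLattice isDistributiveLattice using (isLattice; sym; trans; ∧-congʳ)
  open IsCommutativeMonoid isCommutativeMonoid using (comm)

  lattice : Lattice c ℓ
  lattice = record { isLattice = isLattice }

  -- The standard library orders a lattice by  x ≈ x ∧ y,  the symmetric form of  _≤_.
  open Poset (LatticeProperties.poset lattice)
    using () renaming (refl to ≈∧-refl; trans to ≈∧-trans)

  ≤-refl : ∀ {x} → x ≤ x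
  ≤-refl = sym ≈∧-refl

  ≤-trans : ∀ {x y z} → x ≤ y → y ≤ z → x ≤ z
  ≤-trans x≤y y≤z = sym (≈∧-trans (sym x≤y) (sym y≤z))

  ≤-respˡ-≈ : ∀ {x x' y} → x ≈ x' → x ≤ y → x' ≤ y
  ≤-respˡ-≈ x≈x' x≤y = trans (∧-congʳ (sym x≈x')) (trans x≤y x≈x')

  F-mono : ∀ {x y} → x ≤ y → F x ≤ F y
  F-mono {x} {y} x≤y = T2₂ x (F y) (≤-trans x≤y (T2₁ y (F y) ≤-refl))

  P-mono : ∀ {x y} → x ≤ y → P x ≤ P y
  P-mono {x} {y} x≤y = T1₂ x (P y) (≤-trans x≤y (T1₁ y (P y) ≤-refl))

  modus-ponens : ∀ x y → x · (x →' y) ≤ y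
  modus-ponens x y = ≤-respˡ-≈ (comm (x →' y) x) (residuation₂ (x →' y) x y ≤-refl)

  G-F-modus-ponens : ∀ x y → G x · F (x →' y) ≤ F y
  G-F-modus-ponens x y = ≤-trans (T4G x (x →' y)) (F-mono (modus-ponens x y))

  H-P-modus-ponens : ∀ x y → H x · P (x →' y) ≤ P y
  H-P-modus-ponens x y = ≤-trans (T4H x (x →' y)) (P-mono (modus-ponens x y))

mainTheorem4 : ∀ {c ℓ : Level} (A : TenseICRDL c ℓ) → ∀ x y → TenseICRDL._≤_ A (TenseICRDL._·_ A (TenseICRDL.G A x) (TenseICRDL.F A (TenseICRDL._→'_ A x y))) (TenseICRDL.F A y) × TenseICRDL._≤_ A (TenseICRDL._·_ A (TenseICRDL.H A x) (TenseICRDL.P A (TenseICRDL._→'_ A x y))) (TenseICRDL.P A y)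
mainTheorem4 A x y = G-F-modus-ponens x y , H-P-modus-ponens x y
  where open TenseICRDLProperties A
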